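{- Let $n$ be a positive integer and $a,b$ two coprime positive integers, and suppose $n=xa-yb$ with $x,y\in\mathbb{Z}$. Then $$n\in\langle a,b\rangle\setminus\big(a\{0,\dots,b-1\}\big)\iff\Big\lfloor\frac xb\Big\rfloor\neq\Big\lfloor\frac ya\Big\rfloor.$$
   Context: $\langle a,b\rangle=\{ia+jb: i,j\in\mathbb{N}\}$; $a\{0,\dots,b-1\}=\{ka: k\in\{0,\dots,b-1\}\}$; $\lfloor\cdot\rfloor$ is the floor function. -}

module Defs where

open import Data.Nat using (ℕ; _+_; _*_; _<_)
open import Data.Product using (∃; ∃-syntax; _×_)
open import Relation.Binary.PropositionalEquality using (_≡_)

InSemigroup : ℕ → ℕ → ℕ → Set
InSemigroup a b n = ∃[ i ] ∃[ j ] n ≡ i * a + j * b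

InMultiples : ℕ → ℕ → ℕ → Set
InMultiples a b n = ∃[ k ] (k < b × n ≡ k * a)

{-# OPTIONS --safe #-}
module Submission where

-- Write x = r + q b and y = s + p a with 0 ≤ r < b and 0 ≤ s < a, so that
-- n + s b = r a + (q - p) a b. Coprimality makes the representation of the
-- multiples k a with k < b in ⟨a,b⟩ unique (no positive b-coefficient), and
-- r a < a b. Hence q = p forces n = r a ∈ a{0,…,b-1} as soon as n ∈ ⟨a,b⟩;
-- q > p gives n = r a + ((q - p) a - s) b with positive b-coefficient; and
-- q < p is impossible.

open import Defs
open import Data.Nat using (ℕ; suc; NonZero)
open import Data.Nat.Coprimality using (Coprime)
open import Data.Product using (_×_; _,_)
open import Data.Empty using (⊥-elim)
open import Relation.Binary.PropositionalEquality using (_≡_; _≢_; refl; sym; trans; cong; cong₂; subst; module ≡-Reasoning)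
open import Relation.Nullary using (¬_)
open import Function.Bundles using (_⇔_; mk⇔; module Equivalence)
open import Function using (_∘_)

module _ {a b : ℕ} .{{_ : NonZero a}} where

  open import Data.Nat using (_+_; _∸_; _*_; _<_)
  open import Data.Nat.Properties
  open import Data.Nat.Coprimality using (coprime-divisor)
  open import Data.Nat.Divisibility using (_∣_; ∣⇒≤; ∣m+n∣m⇒∣n; n∣m*n)

  k<b⇒k*a<a*b : ∀ {k} → k < b → k * a < a * b
  k<b⇒k*a<a*b {k} k<b = subst (k * a <_) (*-comm b a) (*-monoˡ-< a k<b)

  i*a+c*b≡k*a⇒c≡0 : ∀ {i c k} → Coprime a b → k < b → i * a + c * b ≡ k * a → c ≡ 0
  i*a+c*b≡k*a⇒c≡0 {c = 0} _ _ _ = refl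
  i*a+c*b≡k*a⇒c≡0 {i} {c@(suc _)} {k} cop k<b eq = ⊥-elim (<-irrefl refl (begin-strict
      k * a          <⟨ k<b⇒k*a<a*b k<b ⟩
      a * b          ≤⟨ *-monoˡ-≤ b (∣⇒≤ a∣c) ⟩
      c * b          ≤⟨ m≤n+m (c * b) (i * a) ⟩
      i * a + c * b  ≡⟨ eq ⟩
      k * a          ∎))
    where
    open ≤-Reasoning
    a∣c*b : a ∣ c * b
    a∣c*b = ∣m+n∣m⇒∣n (subst (a ∣_) (sym eq) (n∣m*n k)) (n∣m*n i)
    a∣c : a ∣ c
    a∣c = coprime-divisor cop (subst (a ∣_) (*-comm c b) a∣c*b)

  m+[1+k]*a*b≢r*a : ∀ {m k r} → r < b → m + suc k * a * b ≢ r * a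
  m+[1+k]*a*b≢r*a {m} {k} {r} r<b eq = <-irrefl refl (begin-strict
      r * a              <⟨ k<b⇒k*a<a*b r<b ⟩
      a * b              ≤⟨ *-monoˡ-≤ b (m≤n*m a (suc k)) ⟩
      suc k * a * b      ≤⟨ m≤n+m (suc k * a * b) m ⟩
      m + suc k * a * b  ≡⟨ eq ⟩
      r * a              ∎)
    where open ≤-Reasoning

  InSemigroup⇒InMultiples : ∀ {n r s} → Coprime a b → r < b → n + s * b ≡ r * a →
                            InSemigroup a b n → InMultiples a b n
  InSemigroup⇒InMultiples {n} {r} {s} cop r<b eq (i , j , n≡) = r , r<b , n≡r*a
    where
    open ≡-Reasoning
    j+s≡0 : j + s ≡ 0
    j+s≡0 = i*a+c*b≡k*a⇒c≡0 {i = i} cop r<b (begin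
      i * a + (j + s) * b      ≡⟨ cong (i * a +_) (*-distribʳ-+ b j s) ⟩
      i * a + (j * b + s * b)  ≡⟨ sym (+-assoc (i * a) (j * b) (s * b)) ⟩
      i * a + j * b + s * b    ≡⟨ cong (_+ s * b) (sym n≡) ⟩
      n + s * b                ≡⟨ eq ⟩
      r * a                    ∎)
    n≡r*a : n ≡ r * a
    n≡r*a = begin
      n          ≡⟨ sym (+-identityʳ n) ⟩
      n + 0 * b  ≡⟨ cong (λ t → n + t * b) (sym (m+n≡0⇒n≡0 j j+s≡0)) ⟩
      n + s * b  ≡⟨ eq ⟩
      r * a      ∎

  positive-coefficient⇒¬InMultiples : ∀ {n i c} → Coprime a b → 0 < c → n ≡ i * a + c * b →
                                      ¬ InMultiples a b n
  positive-coefficient⇒¬InMultiples {i = i} cop 0<c n≡ (k , k<b , n≡k*a) =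
    <⇒≢ 0<c (sym (i*a+c*b≡k*a⇒c≡0 {i = i} cop k<b (trans (sym n≡) n≡k*a)))

  n+s*b≡r*a+[1+k]*a*b⇒InSemigroup×¬InMultiples :
    ∀ {n r s k} → Coprime a b → s < a → n + s * b ≡ r * a + suc k * a * b →
    InSemigroup a b n × ¬ InMultiples a b n
  n+s*b≡r*a+[1+k]*a*b⇒InSemigroup×¬InMultiples {n} {r} {s} {k} cop s<a eq =
    (r , c , n≡) , positive-coefficient⇒¬InMultiples {i = r} cop (m<n⇒0<n∸m s<K) n≡
    where
    open ≡-Reasoning
    K = suc k * a
    c = K ∸ s
    s<K : s < K
    s<K = <-≤-trans s<a (m≤n*m a (suc k))
    n≡ : n ≡ r * a + c * b
    n≡ = +-cancelʳ-≡ (s * b) n (r * a + c * b) (begin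
      n + s * b                ≡⟨ eq ⟩
      r * a + K * b            ≡⟨ cong (λ t → r * a + t * b) (sym (m∸n+n≡m (<⇒≤ s<K))) ⟩
      r * a + (c + s) * b      ≡⟨ cong (r * a +_) (*-distribʳ-+ b c s) ⟩
      r * a + (c * b + s * b)  ≡⟨ sym (+-assoc (r * a) (c * b) (s * b)) ⟩
      r * a + c * b + s * b    ∎)

open import Data.Integer using (ℤ; +_; +[1+_]; -[1+_]; 0ℤ; -_; _+_; _-_; _*_)
open import Data.Integer.Properties using (pos-*; +-injective; i≡j⇒i-j≡0; i-j≡0⇒i≡j)
open import Data.Integer.DivMod using (_/ℕ_; _%ℕ_; a≡a%ℕn+[a/ℕn]*n; n%ℕd<d)
open import Data.Integer.Tactic.RingSolver using (solve-∀)
import Data.Nat as ℕ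
import Data.Nat.Properties as ℕₚ

gap-equation : ∀ N R Q S P A B → N ≡ (R + Q * B) * A - (S + P * A) * B →
               N + S * B ≡ R * A + (Q - P) * A * B
gap-equation N R Q S P A B eq = trans (cong (_+ S * B) eq) (expand R Q S P A B)
  where
  expand : ∀ R Q S P A B → (R + Q * B) * A - (S + P * A) * B + S * B ≡ R * A + (Q - P) * A * B
  expand = solve-∀

move-gap : ∀ N S R E A B → N + S * B ≡ R * A + E * A * B → N + S * B + (- E) * A * B ≡ R * A
move-gap N S R E A B eq = trans (cong (λ t → t + (- E) * A * B) eq) (cancel R E A B)
  where
  cancel : ∀ R E A B → R * A + E * A * B + (- E) * A * B ≡ R * A
  cancel = solve-∀

pos-*-* : ∀ m n k → + (m ℕ.* n ℕ.* k) ≡ + m * + n * + k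
pos-*-* m n k = trans (pos-* (m ℕ.* n) k) (cong (_* + k) (pos-* m n))

module _ {a b : ℕ} where

  nonnegative-gap : ∀ {n r s} m → + n + + s * + b ≡ + r * + a + + m * + a * + b →
                    n ℕ.+ s ℕ.* b ≡ r ℕ.* a ℕ.+ m ℕ.* a ℕ.* b
  nonnegative-gap {n} {r} {s} m eq = +-injective (begin
    + n + + (s ℕ.* b)                ≡⟨ cong (_+_ (+ n)) (pos-* s b) ⟩
    + n + + s * + b                  ≡⟨ eq ⟩
    + r * + a + + m * + a * + b      ≡⟨ sym (cong₂ _+_ (pos-* r a) (pos-*-* m a b)) ⟩
    + (r ℕ.* a) + + (m ℕ.* a ℕ.* b)  ∎)
    where open ≡-Reasoning

  negative-gap : ∀ {n r s} k → + n + + s * + b ≡ + r * + a + -[1+ k ] * + a * + b →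
                 n ℕ.+ s ℕ.* b ℕ.+ suc k ℕ.* a ℕ.* b ≡ r ℕ.* a
  negative-gap {n} {r} {s} k eq = +-injective (begin
    + n + + (s ℕ.* b) + + (suc k ℕ.* a ℕ.* b)
      ≡⟨ cong₂ _+_ (cong (_+_ (+ n)) (pos-* s b)) (pos-*-* (suc k) a b) ⟩
    + n + + s * + b + + suc k * + a * + b      ≡⟨ move-gap (+ n) (+ s) (+ r) -[1+ k ] (+ a) (+ b) eq ⟩
    + r * + a                                  ≡⟨ sym (pos-* r a) ⟩
    + (r ℕ.* a)                                ∎)
    where open ≡-Reasoning

  module _ .{{_ : NonZero a}} where

    InSemigroup×¬InMultiples⇔gap≢0 : ∀ {n r s} → Coprime a b → r ℕ.< b → s ℕ.< a → (e : ℤ) →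
      + n + + s * + b ≡ + r * + a + e * + a * + b →
      (InSemigroup a b n × ¬ InMultiples a b n) ⇔ (e ≢ 0ℤ)
    InSemigroup×¬InMultiples⇔gap≢0 {n} {r} {s} cop r<b s<a (+ 0) eq = mk⇔
      (λ (n∈S , n∉M) _ → n∉M (InSemigroup⇒InMultiples {s = s} cop r<b n+s*b≡r*a n∈S))
      (λ 0≢0 → ⊥-elim (0≢0 refl))
      where
      n+s*b≡r*a = trans (nonnegative-gap {n} {r} {s} 0 eq) (ℕₚ.+-identityʳ (r ℕ.* a))
    InSemigroup×¬InMultiples⇔gap≢0 {n} {r} {s} cop r<b s<a +[1+ k ] eq =
      mk⇔ (λ _ ()) (λ _ → n+s*b≡r*a+[1+k]*a*b⇒InSemigroup×¬InMultiples {r = r} {k = k} cop s<a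
                                (nonnegative-gap {n} {r} {s} (suc k) eq))
    InSemigroup×¬InMultiples⇔gap≢0 {n} {r} {s} cop r<b s<a -[1+ k ] eq =
      mk⇔ (λ _ ()) (λ _ → ⊥-elim (m+[1+k]*a*b≢r*a {k = k} r<b (negative-gap {n} {r} {s} k eq)))

lemma21 : (n a b : ℕ) .{{_ : NonZero n}} .{{_ : NonZero a}} .{{_ : NonZero b}} →
    Coprime a b → (x y : ℤ) → + n ≡ x * + a - y * + b →
    (InSemigroup a b n × ¬ InMultiples a b n) ⇔ (¬ (x /ℕ b ≡ y /ℕ a))
lemma21 n a b cop x y n≡ =
  mk⇔ (λ n∈S q≡p → to n∈S (i≡j⇒i-j≡0 q≡p)) (λ q≢p → from (q≢p ∘ i-j≡0⇒i≡j q p))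
  where
  q = x /ℕ b
  p = y /ℕ a
  n≡divided : + n ≡ (+ (x %ℕ b) + q * + b) * + a - (+ (y %ℕ a) + p * + a) * + b
  n≡divided = trans n≡ (cong₂ (λ u v → u * + a - v * + b) (a≡a%ℕn+[a/ℕn]*n x b) (a≡a%ℕn+[a/ℕn]*n y a))
  open Equivalence (InSemigroup×¬InMultiples⇔gap≢0 cop (n%ℕd<d x b) (n%ℕd<d y a) (q - p)
    (gap-equation (+ n) (+ (x %ℕ b)) q (+ (y %ℕ a)) p (+ a) (+ b) n≡divided))
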